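{- Let $W$ be a set of eight distinct MacMahon cubes such that $G_W$ has eight edges. If $G_W$ has exactly three (respectively, exactly four) connected components, none of which is a tree, then the solution number of $W$ for the target $\mathrm{Ba}$ is $8$ (respectively, $16$).
   Context: A MacMahon cube is a cube whose six faces are painted with the colors $1,\dots,6$, each used once, up to rotation (there are $30$ of them). At each vertex three faces meet; reading their colors clockwise as seen from outside gives a cyclic triple, and the corner number of the vertex is the cyclic rotation of this triple of smallest three-digit value; each MacMahon cube has $8$ distinct corner numbers. $\mathrm{Ba}$ denotes the MacMahon cube whose corner numbers are $\{123,134,146,162,253,265,354,456\}$. Every MacMahon cube other than $\mathrm{Ba}$ shares either $0$ or exactly $2$ corner numbers with $\mathrm{Ba}$. $M$ is the multigraph whose vertex set is the $8$ corner numbers of $\mathrm{Ba}$, with one edge, labeled $C$, joining the two shared corner numbers for each MacMahon cube $C\neq\mathrm{Ba}$ sharing exactly two corner numbers with $\mathrm{Ba}$ ($20$ edges, no loops, some parallel pairs). For a set $W$ of MacMahon cubes, $G_W$ is the subgraph of $M$ with all $8$ vertices and exactly the edges labeled by cubes in $W$. A solution for target $\mathrm{Ba}$ is a bijection $\sigma$ from $W$ to the corner numbers of $\mathrm{Ba}$ with $\sigma(C)$ a corner number of $C$ for all $C\in W$; the solution number is the number of such bijections. An isolated vertex counts as a tree component. -}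

module Defs where

open import Data.Nat using (ℕ; suc; _+_; _*_; _⊓_; _≟_; _≤_)
open import Data.Nat.DivMod using (_%_; m%n<n)
open import Data.Fin using (Fin; zero; suc; toℕ; fromℕ<)
open import Data.List using (List; []; _∷_; length; filter; tabulate)
open import Data.List.Membership.Propositional using (_∈_)
open import Data.List.Membership.DecPropositional _≟_ using (_∈?_)
open import Data.List.Relation.Unary.All using (All)
open import Data.List.Relation.Unary.Unique.Propositional using (Unique)
open import Data.Vec using (Vec; lookup)
open import Data.Product using (Σ; ∃; _×_; _,_)
open import Relation.Binary.PropositionalEquality using (_≡_; _≢_)
open import Relation.Binary.Construct.Closure.ReflexiveTransitive using (Star)
open import Relation.Nullary using (¬_)
open import Function.Bundles using (_⇔_)

-- Faces of the cube.  Coordinates: top = +z, bottom = -z, front = -y,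
-- back = +y, right = +x, left = -x.

data Face : Set where
  top bottom front back left right : Face

-- A painting of the faces with colours (colours are the naturals 1..6).
Coloring : Set
Coloring = Face → ℕ

IsMacMahon : Coloring → Set
IsMacMahon c = (∀ f → 1 ≤ c f × c f ≤ 6) × (∀ f g → c f ≡ c g → f ≡ g)

-- Rotations: generated by the quarter turn about the vertical axis and the
-- quarter turn about the left-right axis (these generate the whole rotation
-- group of the cube).
turnZ : Face → Face
turnZ top = top
turnZ bottom = bottom
turnZ front = right
turnZ right = back
turnZ back = left
turnZ left = front

turnX : Face → Face
turnX left = left
turnX right = right
turnX top = front
turnX front = bottom
turnX bottom = back
turnX back = top

data RotStep (c c' : Coloring) : Set where
  stepZ : (∀ f → c' f ≡ c (turnZ f)) → RotStep c c'
  stepX : (∀ f → c' f ≡ c (turnX f)) → RotStep c c'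

SameCube : Coloring → Coloring → Set
SameCube = Star RotStep

-- Corners.  The three faces at each vertex listed clockwise as seen from
-- outside the cube.

cornerFaces : List (Face × Face × Face)
cornerFaces =
    (right , top , back)
  ∷ (right , back , bottom)
  ∷ (right , front , top)
  ∷ (right , bottom , front)
  ∷ (left , back , top)
  ∷ (left , bottom , back)
  ∷ (left , top , front)
  ∷ (left , front , bottom)
  ∷ []

digits3 : ℕ → ℕ → ℕ → ℕ
digits3 a b c = 100 * a + 10 * b + c

cornerNumber : ℕ → ℕ → ℕ → ℕ
cornerNumber a b c = digits3 a b c ⊓ digits3 b c a ⊓ digits3 c a b

cornerNumbers : Coloring → List ℕ
cornerNumbers c = Data.List.map (λ { (f , g , h) → cornerNumber (c f) (c g) (c h) }) cornerFaces

baCornerVec : Vec ℕ 8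
baCornerVec = 123 Data.Vec.∷ 134 Data.Vec.∷ 146 Data.Vec.∷ 162 Data.Vec.∷
              253 Data.Vec.∷ 265 Data.Vec.∷ 354 Data.Vec.∷ 456 Data.Vec.∷ Data.Vec.[]

-- vertices of M: the eight corner numbers of Ba, indexed by Fin 8
baCorner : Fin 8 → ℕ
baCorner = lookup baCornerVec

baCornerList : List ℕ
baCornerList = Data.Vec.toList baCornerVec

sharedCount : Coloring → ℕ
sharedCount c = length (filter (_∈? cornerNumbers c) baCornerList)

Incident : Coloring → Fin 8 → Set
Incident c v = baCorner v ∈ cornerNumbers c

Joins : Coloring → Fin 8 → Fin 8 → Set
Joins c u v = sharedCount c ≡ 2 × u ≢ v × Incident c u × Incident c v

edgeCount : (Fin 8 → Coloring) → ℕ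
edgeCount W = length (filter (λ c → sharedCount c ≟ 2) (tabulate W))

Adj : (Fin 8 → Coloring) → Fin 8 → Fin 8 → Set
Adj W u v = Σ (Fin 8) λ i → Joins (W i) u v

Reachable : (Fin 8 → Coloring) → Fin 8 → Fin 8 → Set
Reachable W = Star (Adj W)

-- G_W has exactly k connected components: a surjective labelling of the
-- vertices by Fin k whose fibres are exactly the reachability classes
NumComponents : (Fin 8 → Coloring) → ℕ → Set
NumComponents W k =
  Σ (Fin 8 → Fin k) λ f →
    (∀ j → ∃ λ v → f v ≡ j) × (∀ u v → (f u ≡ f v) ⇔ Reachable W u v)

next : ∀ {m} → Fin (suc m) → Fin (suc m)
next {m} i = fromℕ< (m%n<n (suc (toℕ i)) (suc m))

record Cycle (W : Fin 8 → Coloring) : Set where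
  field
    m     : ℕ
    vs    : Fin (suc (suc m)) → Fin 8
    es    : Fin (suc (suc m)) → Fin 8
    vsInj : ∀ i j → vs i ≡ vs j → i ≡ j
    esInj : ∀ i j → es i ≡ es j → i ≡ j
    joins : ∀ j → Joins (W (es j)) (vs j) (vs (next j))

-- the connected component of v contains a cycle (i.e. is not a tree)
ComponentHasCycle : (Fin 8 → Coloring) → Fin 8 → Set
ComponentHasCycle W v = Σ (Cycle W) λ cy → Reachable W v (Cycle.vs cy zero)

NoTreeComponent : (Fin 8 → Coloring) → Set
NoTreeComponent W = ∀ v → ComponentHasCycle W v

-- Solutions.  A bijection from W to the corners of Ba is given as a vector
-- σ whose i-th entry is the image of the cube W i.

IsSolution : (Fin 8 → Coloring) → Vec (Fin 8) 8 → Set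
IsSolution W σ =
    (∀ i j → lookup σ i ≡ lookup σ j → i ≡ j)
  × (∀ v → ∃ λ i → lookup σ i ≡ v)
  × (∀ i → Incident (W i) (lookup σ i))

-- the solution number of W is n: the solutions are exactly the entries of a
-- duplicate-free list of length n
SolutionNumber : (Fin 8 → Coloring) → ℕ → Set
SolutionNumber W n =
  Σ (List (Vec (Fin 8) 8)) λ L →
    length L ≡ n × Unique L × All (IsSolution W) L × (∀ σ → IsSolution W σ → σ ∈ L)

{-# OPTIONS --safe #-}
-- Every vertex of G_W reaches a cycle, the cycles chosen in the k components are vertex-disjoint,
-- and G_W has as many edges as vertices.  Give each vertex off the cycles the edge along which it
-- steps towards the cycles (a breadth-first parent), and the vertices of each cycle the cycle edges
-- taken in one of its two directions.  For each of the 2^k choices of directions this assignment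
-- vertex ↦ edge is injective, hence bijective, and its inverse is a solution.  Conversely, a
-- solution must give every vertex off the cycles its parent edge (descending induction on the
-- distance to the cycles) and must run around each cycle in a single direction.
module Submission where

open import Defs
open import Data.Fin using (Fin)
open import Data.Product using (_×_)
open import Relation.Binary.PropositionalEquality using (_≡_; _≢_)
open import Relation.Nullary using (¬_)

open import Data.Bool using (Bool; true; false)
open import Data.Empty using (⊥-elim; ⊥-elim-irr)
open import Data.Fin as Fin using (zero; suc; toℕ; fromℕ; inject₁; punchOut)
open import Data.Fin.Induction using (<-weakInduction)
open import Data.Fin.Properties
  using (suc-injective; toℕ-injective; toℕ-fromℕ<; toℕ-fromℕ; toℕ-inject₁; toℕ<n; 0≢1+n; any?;
         punchOut-injective; <⇒notInjective)
open import Data.Fin.Relation.Unary.Top using (view; ‵fromℕ; ‵inject₁)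
open import Data.List as List using (List; []; _∷_; length; filter; _++_)
open import Data.List.Extrema.Nat using (max; xs≤max)
open import Data.List.Membership.Propositional using (_∈_)
open import Data.List.Membership.Propositional.Properties using (∈-map⁺; ∈-map⁻; ∈-++⁺ˡ; ∈-++⁺ʳ)
open import Data.List.Properties using (length-++; length-map; length-tabulate; filter-complete; filter-some)
open import Data.List.Relation.Unary.All as All using (All)
open import Data.List.Relation.Unary.All.Properties using (all-filter; tabulate⁻)
open import Data.List.Relation.Unary.Any using (here)
open import Data.List.Relation.Unary.Any.Properties using (tabulate⁺)
open import Data.List.Relation.Unary.AllPairs using ([]; _∷_)
open import Data.List.Relation.Unary.Unique.Propositional using (Unique)
import Data.List.Relation.Unary.Unique.Propositional.Properties as Unique
open import Data.Nat using (ℕ; zero; suc; _+_; _∸_; _^_; _<_; _≤_; s≤s; _≟_)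
open import Data.List.Membership.DecPropositional _≟_ using (_∈?_)
open import Data.Nat.DivMod using (_%_; m<n⇒m%n≡m; n%n≡0)
open import Data.Nat.Induction using (<-rec)
import Data.Nat.Properties as ℕ
open import Data.Nat.Properties
  using (n<1+n; 1+n≢n; <⇒≢; ≮⇒≥; <-asym; <-≤-trans; ≤-pred; ∸-monoʳ-<; +-identityʳ; anyUpTo?)
open import Data.Product using (Σ; ∃; ∃₂; _,_; proj₁; proj₂)
open import Data.Sum as Sum using (_⊎_; inj₁; inj₂; [_,_])
open import Data.Vec as Vec using (Vec; lookup; tabulate; replicate)
open import Data.Vec.Properties using (∷-injectiveʳ; lookup∘tabulate; tabulate∘lookup; tabulate-cong)
open import Function using (_∘_; id; _⇔_; mk⇔; Equivalence)
open Equivalence using (to; from)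
open import Function.Definitions using (Injective)
open import Relation.Binary.Construct.Closure.ReflexiveTransitive as Star using (Star; ε; _◅_; _◅◅_; return)
open import Relation.Binary.PropositionalEquality using (refl; sym; trans; cong; cong₂; subst; module ≡-Reasoning)
open import Relation.Nullary using (Dec; yes; no; does)
open import Relation.Nullary.Decidable using (_×-dec_; _⊎-dec_)
open import Relation.Unary using (Decidable)

private
  variable
    k n : ℕ

-- Cyclic order on Fin (suc n)

next-inject₁ : (i : Fin n) → next (inject₁ i) ≡ suc i
next-inject₁ {n} i = toℕ-injective (begin
  toℕ (next (inject₁ i))          ≡⟨ toℕ-fromℕ< _ ⟩
  suc (toℕ (inject₁ i)) % suc n   ≡⟨ cong (λ t → suc t % suc n) (toℕ-inject₁ i) ⟩
  suc (toℕ i) % suc n             ≡⟨ m<n⇒m%n≡m (s≤s (toℕ<n i)) ⟩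
  suc (toℕ i)                     ∎)
  where open ≡-Reasoning

next-fromℕ : ∀ n → next (fromℕ n) ≡ zero
next-fromℕ n = toℕ-injective (begin
  toℕ (next (fromℕ n))        ≡⟨ toℕ-fromℕ< _ ⟩
  suc (toℕ (fromℕ n)) % suc n ≡⟨ cong (λ t → suc t % suc n) (toℕ-fromℕ n) ⟩
  suc n % suc n               ≡⟨ n%n≡0 (suc n) ⟩
  zero                        ∎)
  where open ≡-Reasoning

prev : Fin (suc n) → Fin (suc n)
prev zero    = fromℕ _
prev (suc i) = inject₁ i

next-prev : (i : Fin (suc n)) → next (prev i) ≡ i
next-prev zero    = next-fromℕ _
next-prev (suc i) = next-inject₁ i

prev-next : (i : Fin (suc n)) → prev (next i) ≡ i
prev-next {n} i with view i
... | ‵fromℕ     rewrite next-fromℕ n = refl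
... | ‵inject₁ j rewrite next-inject₁ j = refl

prev-injective : Injective _≡_ _≡_ (prev {n})
prev-injective {x = i} {j} eq = trans (sym (next-prev i)) (trans (cong next eq) (next-prev j))

next-induction : (P : Fin (suc n) → Set) → P zero → (∀ i → P i → P (next i)) → ∀ i → P i
next-induction P P₀ step = <-weakInduction P P₀ (λ i Pi → subst P (next-inject₁ i) (step _ Pi))

next≢ : (i : Fin (suc (suc n))) → next i ≢ i
next≢ i with view i
... | ‵fromℕ     = λ eq → 0≢1+n (trans (sym (next-fromℕ _)) eq)
... | ‵inject₁ j = λ eq → 1+n≢n (trans (cong toℕ (trans (sym (next-inject₁ j)) eq)) (toℕ-inject₁ j))

prev≢ : (i : Fin (suc (suc n))) → prev i ≢ i
prev≢ i eq = next≢ (prev i) (trans (next-prev i) (sym eq))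

-- Finite combinatorics

injective⇒surjective : (g : Fin n → Fin n) → Injective _≡_ _≡_ g → ∀ e → ∃ λ v → g v ≡ e
injective⇒surjective {zero}  g g-inj ()
injective⇒surjective {suc n} g g-inj e with any? (λ v → g v Fin.≟ e)
... | yes hit = hit
... | no miss = ⊥-elim (<⇒notInjective (n<1+n n) squeeze-injective)
  where
  squeeze : Fin (suc n) → Fin n
  squeeze v = punchOut {i = e} {j = g v} (λ eq → miss (v , sym eq))
  squeeze-injective : Injective _≡_ _≡_ squeeze
  squeeze-injective eq = g-inj (punchOut-injective {i = e} _ _ eq)

module FinInverse (g : Fin n → Fin n) (g-injective : Injective _≡_ _≡_ g) where

  g⁻¹ : Fin n → Fin n
  g⁻¹ e = proj₁ (injective⇒surjective g g-injective e)

  inverseʳ : ∀ e → g (g⁻¹ e) ≡ e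
  inverseʳ e = proj₂ (injective⇒surjective g g-injective e)

  inverseˡ : ∀ v → g⁻¹ (g v) ≡ v
  inverseˡ v = g-injective (inverseʳ (g v))

  g⁻¹-injective : Injective _≡_ _≡_ g⁻¹
  g⁻¹-injective {x} {y} eq = trans (sym (inverseʳ x)) (trans (cong g eq) (inverseʳ y))

  preimage-unique : ∀ {v e} → g v ≡ e → v ≡ g⁻¹ e
  preimage-unique {e = e} eq = g-injective (trans eq (sym (inverseʳ e)))

inverses-determine : (g h : Fin n → Fin n)
                     (g-injective : Injective _≡_ _≡_ g) (h-injective : Injective _≡_ _≡_ h) →
                     (∀ e → FinInverse.g⁻¹ g g-injective e ≡ FinInverse.g⁻¹ h h-injective e) →
                     ∀ v → g v ≡ h v
inverses-determine g h g-injective h-injective same v = begin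
  g v             ≡⟨ sym (H.inverseʳ (g v)) ⟩
  h (H.g⁻¹ (g v)) ≡⟨ cong h (sym (same (g v))) ⟩
  h (G.g⁻¹ (g v)) ≡⟨ cong h (G.inverseˡ v) ⟩
  h v             ∎
  where
  open ≡-Reasoning
  module G = FinInverse g g-injective
  module H = FinInverse h h-injective

Minimal : (ℕ → Set) → ℕ → Set
Minimal P m = P m × (∀ {m'} → m' < m → ¬ P m')

least : {P : ℕ → Set} → Decidable P → ∀ {n} → P n → ∃ (Minimal P)
least {P} P? {n} = <-rec (λ n → P n → ∃ (Minimal P)) step n
  where
  step : ∀ n → (∀ {m} → m < n → P m → ∃ (Minimal P)) → P n → ∃ (Minimal P)
  step n smaller Pn with anyUpTo? P? n
  ... | yes (m , m<n , Pm) = smaller m<n Pm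
  ... | no none            = n , Pn , λ m<n Pm → none (_ , m<n , Pm)

module Counting {A : Set} {P : A → Set} (P? : Decidable P) where

  count≡length⇒all : ∀ xs → length (filter P? xs) ≡ length xs → All P xs
  count≡length⇒all xs eq = subst (All P) (filter-complete P? eq) (all-filter P? xs)

  count≡0⇒none : (g : Fin n → A) → length (filter P? (List.tabulate g)) ≡ 0 → ∀ v → ¬ P (g v)
  count≡0⇒none g eq v Pv = <⇒≢ (filter-some P? (tabulate⁺ v Pv)) (sym eq)

  count≡1⇒single : (g : Fin n → A) → length (filter P? (List.tabulate g)) ≡ 1 →
                   ∃ λ a → ∀ v → P (g v) ⇔ v ≡ a
  count≡1⇒single {suc n} g eq with P? (g zero)
  ... | yes P₀ = zero , λ
        { zero    → mk⇔ (λ _ → refl) (λ _ → P₀)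
        ; (suc v) → mk⇔ (⊥-elim ∘ count≡0⇒none (g ∘ suc) (ℕ.suc-injective eq) v) (λ ()) }
  ... | no ¬P₀ with count≡1⇒single (g ∘ suc) eq
  ...   | a , only = suc a , λ
        { zero    → mk⇔ (⊥-elim ∘ ¬P₀) (λ ())
        ; (suc v) → mk⇔ (cong suc ∘ to (only v)) (from (only v) ∘ suc-injective) }

  count≡2⇒pair : (g : Fin n → A) → length (filter P? (List.tabulate g)) ≡ 2 →
                 ∃₂ λ a b → ∀ v → P (g v) ⇔ (v ≡ a ⊎ v ≡ b)
  count≡2⇒pair {suc n} g eq with P? (g zero)
  ... | yes P₀ with count≡1⇒single (g ∘ suc) (ℕ.suc-injective eq)
  ...   | b , only = zero , suc b , λ
        { zero    → mk⇔ (λ _ → inj₁ refl) (λ _ → P₀)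
        ; (suc v) → mk⇔ (inj₂ ∘ cong suc ∘ to (only v)) [ (λ ()) , from (only v) ∘ suc-injective ] }
  count≡2⇒pair {suc n} g eq | no ¬P₀ with count≡2⇒pair (g ∘ suc) eq
  ...   | a , b , only = suc a , suc b , λ
        { zero    → mk⇔ (⊥-elim ∘ ¬P₀) [ (λ ()) , (λ ()) ]
        ; (suc v) → mk⇔ (Sum.map (cong suc) (cong suc) ∘ to (only v))
                         (from (only v) ∘ Sum.map suc-injective suc-injective) }

boolVecs : ∀ k → List (Vec Bool k)
boolVecs zero    = Vec.[] ∷ []
boolVecs (suc k) = List.map (true Vec.∷_) (boolVecs k) ++ List.map (false Vec.∷_) (boolVecs k)

length-boolVecs : ∀ k → length (boolVecs k) ≡ 2 ^ k
length-boolVecs zero    = refl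
length-boolVecs (suc k) = begin
  length (List.map (true Vec.∷_) cs ++ List.map (false Vec.∷_) cs)
    ≡⟨ length-++ (List.map (true Vec.∷_) cs) ⟩
  length (List.map (true Vec.∷_) cs) + length (List.map (false Vec.∷_) cs)
    ≡⟨ cong₂ _+_ (length-map _ cs) (length-map _ cs) ⟩
  length cs + length cs
    ≡⟨ cong (λ m → m + m) (length-boolVecs k) ⟩
  2 ^ k + 2 ^ k
    ≡⟨ cong (2 ^ k +_) (sym (+-identityʳ (2 ^ k))) ⟩
  2 ^ suc k ∎
  where
  open ≡-Reasoning
  cs : List (Vec Bool k)
  cs = boolVecs k

boolVecs-unique : ∀ k → Unique (boolVecs k)
boolVecs-unique zero    = All.[] ∷ []
boolVecs-unique (suc k) =
  Unique.++⁺ (Unique.map⁺ ∷-injectiveʳ (boolVecs-unique k))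
             (Unique.map⁺ ∷-injectiveʳ (boolVecs-unique k))
             heads-differ
  where
  heads-differ : ∀ {c} → ¬ (c ∈ List.map (true Vec.∷_) (boolVecs k)
                          × c ∈ List.map (false Vec.∷_) (boolVecs k))
  heads-differ (c∈t , c∈f) with ∈-map⁻ (true Vec.∷_) c∈t | ∈-map⁻ (false Vec.∷_) c∈f
  ... | _ , _ , refl | _ , _ , ()

∈-boolVecs : (c : Vec Bool k) → c ∈ boolVecs k
∈-boolVecs Vec.[]          = here refl
∈-boolVecs (true Vec.∷ c)  = ∈-++⁺ˡ (∈-map⁺ (true Vec.∷_) (∈-boolVecs c))
∈-boolVecs (false Vec.∷ c) =
  ∈-++⁺ʳ (List.map (true Vec.∷_) (boolVecs _)) (∈-map⁺ (false Vec.∷_) (∈-boolVecs c))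

enumerated-by-boolVecs : {A : Set} {P : A → Set} (enc : Vec Bool k → A) → Injective _≡_ _≡_ enc →
                         (∀ c → P (enc c)) → (∀ x → P x → ∃ λ c → x ≡ enc c) →
                         Σ (List A) λ L → length L ≡ 2 ^ k × Unique L × All P L × (∀ x → P x → x ∈ L)
enumerated-by-boolVecs {k} {P = P} enc enc-injective sound complete =
    List.map enc (boolVecs k)
  , trans (length-map enc (boolVecs k)) (length-boolVecs k)
  , Unique.map⁺ enc-injective (boolVecs-unique k)
  , All.tabulate (λ x∈ → let c , _ , x≡ = ∈-map⁻ enc x∈ in subst P (sym x≡) (sound c))
  , λ x Px → let c , x≡ = complete x Px in subst (_∈ _) (sym x≡) (∈-map⁺ enc (∈-boolVecs c))

-- Multigraphs on Fin n with n edges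

module Graph (a b : Fin n → Fin n) where

  IsEnd : Fin n → Fin n → Set
  IsEnd i v = v ≡ a i ⊎ v ≡ b i

  Links : Fin n → Fin n → Fin n → Set
  Links i u w = (u ≡ a i × w ≡ b i) ⊎ (u ≡ b i × w ≡ a i)

  links? : ∀ i u w → Dec (Links i u w)
  links? i u w = ((u Fin.≟ a i) ×-dec (w Fin.≟ b i)) ⊎-dec ((u Fin.≟ b i) ×-dec (w Fin.≟ a i))

  links⇒isEndˡ : ∀ {i u w} → Links i u w → IsEnd i u
  links⇒isEndˡ = Sum.map proj₁ proj₁

  links⇒isEndʳ : ∀ {i u w} → Links i u w → IsEnd i w
  links⇒isEndʳ = [ inj₂ ∘ proj₂ , inj₁ ∘ proj₂ ]

  isEnd⇒linked : ∀ {i u w x} → Links i u w → IsEnd i x → x ≡ u ⊎ x ≡ w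
  isEnd⇒linked (inj₁ (refl , refl)) = id
  isEnd⇒linked (inj₂ (refl , refl)) = Sum.swap

  Adjacent : Fin n → Fin n → Set
  Adjacent u w = ∃ λ i → Links i u w

  record SimpleCycle : Set where
    field
      m                : ℕ
      vertex edge      : Fin (suc (suc m)) → Fin n
      vertex-injective : Injective _≡_ _≡_ vertex
      edge-injective   : Injective _≡_ _≡_ edge
      links            : ∀ x → Links (edge x) (vertex x) (vertex (next x))

  IsEndBijection : Vec (Fin n) n → Set
  IsEndBijection σ =
    Injective _≡_ _≡_ (lookup σ) × (∀ v → ∃ λ i → lookup σ i ≡ v) × (∀ i → IsEnd i (lookup σ i))

  module _ (g : Fin n → Fin n) (g-injective : Injective _≡_ _≡_ g) (g-isEnd : ∀ v → IsEnd (g v) v) where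
    open FinInverse g g-injective

    inverse-isEndBijection : IsEndBijection (tabulate g⁻¹)
    inverse-isEndBijection =
        (λ {e} {e'} eq → g⁻¹-injective (begin
           g⁻¹ e                 ≡⟨ sym (lookup∘tabulate g⁻¹ e) ⟩
           lookup (tabulate g⁻¹) e  ≡⟨ eq ⟩
           lookup (tabulate g⁻¹) e' ≡⟨ lookup∘tabulate g⁻¹ e' ⟩
           g⁻¹ e'                ∎))
      , (λ v → g v , trans (lookup∘tabulate g⁻¹ (g v)) (inverseˡ v))
      , (λ e → subst (IsEnd e) (sym (lookup∘tabulate g⁻¹ e))
                 (subst (λ i → IsEnd i (g⁻¹ e)) (inverseʳ e) (g-isEnd (g⁻¹ e))))
      where open ≡-Reasoning

  module EndBijection {σ : Vec (Fin n) n} (σ-bij : IsEndBijection σ) where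

    private
      σ-injective : Injective _≡_ _≡_ (lookup σ)
      σ-injective = proj₁ σ-bij

      σ-surjective : ∀ v → ∃ λ e → lookup σ e ≡ v
      σ-surjective = proj₁ (proj₂ σ-bij)

    σ⁻¹ : Fin n → Fin n
    σ⁻¹ v = proj₁ (σ-surjective v)

    σ⁻¹-injective : Injective _≡_ _≡_ σ⁻¹
    σ⁻¹-injective {u} {v} eq =
      trans (sym (proj₂ (σ-surjective u))) (trans (cong (lookup σ) eq) (proj₂ (σ-surjective v)))

    σ⁻¹-isEnd : ∀ v → IsEnd (σ⁻¹ v) v
    σ⁻¹-isEnd v = subst (IsEnd (σ⁻¹ v)) (proj₂ (σ-surjective v)) (proj₂ (proj₂ σ-bij) (σ⁻¹ v))

    σ⁻¹-inverse : ∀ e → σ⁻¹ (lookup σ e) ≡ e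
    σ⁻¹-inverse e = σ-injective (proj₂ (σ-surjective (lookup σ e)))

    ≡tabulate-inverse : (g : Fin n → Fin n) (g-injective : Injective _≡_ _≡_ g) →
                        (∀ v → σ⁻¹ v ≡ g v) →
                        σ ≡ tabulate (FinInverse.g⁻¹ g g-injective)
    ≡tabulate-inverse g g-injective σ⁻¹≗g = trans (sym (tabulate∘lookup σ)) (tabulate-cong λ e →
      FinInverse.preimage-unique g g-injective (trans (sym (σ⁻¹≗g (lookup σ e))) (σ⁻¹-inverse e)))

  module Orientations {k : ℕ} (cycle : Fin k → SimpleCycle)
    (cycles-disjoint : ∀ {j j' x x'} →
                       SimpleCycle.vertex (cycle j) x ≡ SimpleCycle.vertex (cycle j') x' → j ≡ j')
    (reaches-cycle : ∀ v → ∃ λ j → Star Adjacent v (SimpleCycle.vertex (cycle j) zero))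
    where

    module C (j : Fin k) = SimpleCycle (cycle j)
    open C using (vertex; edge; vertex-injective; edge-injective; links)

    Index : Fin k → Set
    Index j = Fin (suc (suc (C.m j)))

    OnCycle : Fin n → Set
    OnCycle v = ∃₂ λ j (x : Index j) → vertex j x ≡ v

    onCycle? : ∀ v → Dec (OnCycle v)
    onCycle? v = any? λ j → any? λ x → vertex j x Fin.≟ v

    cycle-edge-ends : ∀ {j x v} → IsEnd (edge j x) v → v ≡ vertex j x ⊎ v ≡ vertex j (next x)
    cycle-edge-ends {j} {x} = isEnd⇒linked (links j x)

    isEnd-cycle-edge⇒onCycle : ∀ {j x v} → IsEnd (edge j x) v → OnCycle v
    isEnd-cycle-edge⇒onCycle {j} {x} end =
      [ (λ eq → j , x , sym eq) , (λ eq → j , next x , sym eq) ] (cycle-edge-ends end)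

    cycle-edges-disjoint : ∀ {j j' x x'} → edge j x ≡ edge j' x' → j ≡ j'
    cycle-edges-disjoint {j} {j'} {x} {x'} eq =
      [ cycles-disjoint , cycles-disjoint ]
        (cycle-edge-ends {j'} {x'} (subst (λ i → IsEnd i (vertex j x)) eq (links⇒isEndˡ (links j x))))

    WithinSteps : ℕ → Fin n → Set
    WithinSteps zero    v = OnCycle v
    WithinSteps (suc t) v = WithinSteps t v ⊎ ∃₂ λ i w → Links i v w × WithinSteps t w

    withinSteps? : ∀ t v → Dec (WithinSteps t v)
    withinSteps? zero    v = onCycle? v
    withinSteps? (suc t) v = withinSteps? t v ⊎-dec any? λ i → any? λ w → links? i v w ×-dec withinSteps? t w

    path⇒withinSteps : ∀ {v z} → Star Adjacent v z → OnCycle z → ∃ λ t → WithinSteps t v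
    path⇒withinSteps ε               z-on = zero , z-on
    path⇒withinSteps ((i , l) ◅ path) z-on =
      let t , within = path⇒withinSteps path z-on in suc t , inj₂ (i , _ , l , within)

    distance : ∀ v → ∃ (Minimal λ t → WithinSteps t v)
    distance v =
      let j , path = reaches-cycle v
      in  least (λ t → withinSteps? t v) (proj₂ (path⇒withinSteps path (j , zero , refl)))

    dist : Fin n → ℕ
    dist v = proj₁ (distance v)

    withinSteps-dist : ∀ v → WithinSteps (dist v) v
    withinSteps-dist v = proj₁ (proj₂ (distance v))

    dist-minimal : ∀ v {t} → t < dist v → ¬ WithinSteps t v
    dist-minimal v = proj₂ (proj₂ (distance v))

    dist-≤ : ∀ {t v} → WithinSteps t v → dist v ≤ t
    dist-≤ {t} {v} within = ≮⇒≥ λ t<dist → dist-minimal v t<dist within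

    descent : ∀ v → .(¬ OnCycle v) → ∃₂ λ i w → Links i v w × dist w < dist v
    descent v off with dist v | withinSteps-dist v | dist-minimal v
    ... | zero  | on                        | _       = ⊥-elim-irr (off on)
    ... | suc t | inj₁ near                 | minimal = ⊥-elim (minimal (n<1+n t) near)
    ... | suc t | inj₂ (i , w , l , within) | _       = i , w , l , s≤s (dist-≤ within)

    parentEdge : ∀ v → .(¬ OnCycle v) → Fin n
    parentEdge v off = proj₁ (descent v off)

    parentEdge-descends : ∀ v .(off : ¬ OnCycle v) → ∃ λ w → Links (parentEdge v off) v w × dist w < dist v
    parentEdge-descends v off = proj₂ (descent v off)

    parentEdge-isEnd : ∀ v .(off : ¬ OnCycle v) → IsEnd (parentEdge v off) v
    parentEdge-isEnd v off = links⇒isEndˡ (proj₁ (proj₂ (parentEdge-descends v off)))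

    parentEdge-injective : ∀ {u v} .{off-u : ¬ OnCycle u} .{off-v : ¬ OnCycle v} →
                           parentEdge u off-u ≡ parentEdge v off-v → u ≡ v
    parentEdge-injective {u} {v} {off-u} {off-v} eq
      with parentEdge-descends u off-u | parentEdge-descends v off-v
    ... | _ , lu , du | _ , lv , dv
      with isEnd⇒linked lu (subst (λ i → IsEnd i v) (sym eq) (links⇒isEndˡ lv))
         | isEnd⇒linked lv (subst (λ i → IsEnd i u) eq (links⇒isEndˡ lu))
    ... | inj₁ v≡u  | _         = sym v≡u
    ... | _         | inj₁ u≡v  = u≡v
    ... | inj₂ refl | inj₂ refl = ⊥-elim (<-asym du dv)

    orientedEdge : Bool → (j : Fin k) → Index j → Fin n
    orientedEdge true  j x = edge j x
    orientedEdge false j x = edge j (prev x)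

    orientedEdge-isEnd : ∀ o j x → IsEnd (orientedEdge o j x) (vertex j x)
    orientedEdge-isEnd true  j x = links⇒isEndˡ (links j x)
    orientedEdge-isEnd false j x =
      subst (IsEnd (edge j (prev x)) ∘ vertex j) (next-prev x) (links⇒isEndʳ (links j (prev x)))

    orientedEdge-isCycleEdge : ∀ o j x → ∃ λ y → orientedEdge o j x ≡ edge j y
    orientedEdge-isCycleEdge true  j x = x , refl
    orientedEdge-isCycleEdge false j x = prev x , refl

    orientedEdge-injective : ∀ o j → Injective _≡_ _≡_ (orientedEdge o j)
    orientedEdge-injective true  j = edge-injective j
    orientedEdge-injective false j = prev-injective ∘ edge-injective j

    orientedEdge-sameCycle : ∀ {o o' j j' x x'} → orientedEdge o j x ≡ orientedEdge o' j' x' → j ≡ j'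
    orientedEdge-sameCycle {o} {o'} {j} {j'} {x} {x'} eq = cycle-edges-disjoint (begin
      edge j _              ≡⟨ sym (proj₂ (orientedEdge-isCycleEdge o j x)) ⟩
      orientedEdge o j x    ≡⟨ eq ⟩
      orientedEdge o' j' x' ≡⟨ proj₂ (orientedEdge-isCycleEdge o' j' x') ⟩
      edge j' _             ∎)
      where open ≡-Reasoning

    orientedEdge-zero-injective : ∀ {o o'} j → orientedEdge o j zero ≡ orientedEdge o' j zero → o ≡ o'
    orientedEdge-zero-injective {true}  {true}  j eq = refl
    orientedEdge-zero-injective {false} {false} j eq = refl
    orientedEdge-zero-injective {true}  {false} j eq = ⊥-elim (prev≢ zero (sym (edge-injective j eq)))
    orientedEdge-zero-injective {false} {true}  j eq = ⊥-elim (prev≢ zero (edge-injective j eq))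

    parentEdge≢orientedEdge : ∀ v (off : ¬ OnCycle v) o j x → parentEdge v off ≢ orientedEdge o j x
    parentEdge≢orientedEdge v off o j x eq =
      off (isEnd-cycle-edge⇒onCycle (subst (λ i → IsEnd i v) (trans eq (proj₂ (orientedEdge-isCycleEdge o j x)))
                                           (parentEdge-isEnd v off)))

    assignWith : Vec Bool k → ∀ v → Dec (OnCycle v) → Fin n
    assignWith c v (yes (j , x , _)) = orientedEdge (lookup c j) j x
    assignWith c v (no off)          = parentEdge v off

    assign : Vec Bool k → Fin n → Fin n
    assign c v = assignWith c v (onCycle? v)

    data AssignView (c : Vec Bool k) (v : Fin n) (e : Fin n) : Set where
      on-cycle  : ∀ j x → vertex j x ≡ v → e ≡ orientedEdge (lookup c j) j x → AssignView c v e
      off-cycle : (off : ¬ OnCycle v) → e ≡ parentEdge v off → AssignView c v e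

    assign-view : ∀ c v → AssignView c v (assign c v)
    assign-view c v = viewWith (onCycle? v)
      where
      viewWith : (on? : Dec (OnCycle v)) → AssignView c v (assignWith c v on?)
      viewWith (yes (j , x , eq)) = on-cycle j x eq refl
      viewWith (no off)           = off-cycle off refl

    assign-isEnd : ∀ c v → IsEnd (assign c v) v
    assign-isEnd c v with assign-view c v
    ... | on-cycle j x refl eq = subst (λ i → IsEnd i (vertex j x)) (sym eq) (orientedEdge-isEnd (lookup c j) j x)
    ... | off-cycle off eq     = subst (λ i → IsEnd i v) (sym eq) (parentEdge-isEnd v off)

    assign-onCycle : ∀ c j x → assign c (vertex j x) ≡ orientedEdge (lookup c j) j x
    assign-onCycle c j x with assign-view c (vertex j x)
    ... | off-cycle off _ = ⊥-elim (off (j , x , refl))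
    ... | on-cycle j' x' at eq with cycles-disjoint at
    ...   | refl = trans eq (cong (orientedEdge (lookup c j) j) (vertex-injective j at))

    assign-injective : ∀ c → Injective _≡_ _≡_ (assign c)
    assign-injective c {u} {v} eq with assign-view c u | assign-view c v
    ... | on-cycle j x refl eu | on-cycle j' x' refl ev
      with orientedEdge-sameCycle {lookup c j} {lookup c j'} {j} {j'} {x} {x'} (trans (sym eu) (trans eq ev))
    ...   | refl = cong (vertex j) (orientedEdge-injective (lookup c j) j (trans (sym eu) (trans eq ev)))
    assign-injective c eq | on-cycle j x refl eu | off-cycle off ev =
      ⊥-elim (parentEdge≢orientedEdge _ off (lookup c j) j x (trans (sym ev) (trans (sym eq) eu)))
    assign-injective c eq | off-cycle off eu | on-cycle j x refl ev =
      ⊥-elim (parentEdge≢orientedEdge _ off (lookup c j) j x (trans (sym eu) (trans eq ev)))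
    assign-injective c eq | off-cycle _ eu | off-cycle _ ev = parentEdge-injective (trans (sym eu) (trans eq ev))

    -- Here the count of edges matters: with as many edges as vertices, the injective assign is onto.
    every-edge-on-cycle-or-parent : ∀ e → (∃₂ λ j x → edge j x ≡ e)
                                        ⊎ (∃ λ u → Σ (¬ OnCycle u) λ off → parentEdge u off ≡ e)
    every-edge-on-cycle-or-parent e
      with injective⇒surjective (assign (replicate k true)) (assign-injective (replicate k true)) e
    ... | u , u↦e with assign-view (replicate k true) u
    ...   | on-cycle j x _ eq =
            let y , oriented≡ = orientedEdge-isCycleEdge (lookup (replicate k true) j) j x
            in  inj₁ (j , y , trans (sym oriented≡) (trans (sym eq) u↦e))
    ...   | off-cycle off eq = inj₂ (u , off , trans (sym eq) u↦e)

    matching : Vec Bool k → Vec (Fin n) n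
    matching c = tabulate (FinInverse.g⁻¹ (assign c) (assign-injective c))

    matching-isEndBijection : ∀ c → IsEndBijection (matching c)
    matching-isEndBijection c = inverse-isEndBijection (assign c) (assign-injective c) (assign-isEnd c)

    matching-injective : Injective _≡_ _≡_ matching
    matching-injective {c} {c'} eq = begin
      c                     ≡⟨ sym (tabulate∘lookup c) ⟩
      tabulate (lookup c)   ≡⟨ tabulate-cong same-orientation ⟩
      tabulate (lookup c')  ≡⟨ tabulate∘lookup c' ⟩
      c'                    ∎
      where
      open ≡-Reasoning
      same-inverse : ∀ e → FinInverse.g⁻¹ (assign c) (assign-injective c) e
                         ≡ FinInverse.g⁻¹ (assign c') (assign-injective c') e
      same-inverse e =
        trans (sym (lookup∘tabulate _ e)) (trans (cong (λ σ → lookup σ e) eq) (lookup∘tabulate _ e))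
      same-assignment : ∀ v → assign c v ≡ assign c' v
      same-assignment =
        inverses-determine (assign c) (assign c') (assign-injective c) (assign-injective c') same-inverse
      same-orientation : ∀ j → lookup c j ≡ lookup c' j
      same-orientation j = orientedEdge-zero-injective j (begin
        orientedEdge (lookup c j) j zero   ≡⟨ sym (assign-onCycle c j zero) ⟩
        assign c (vertex j zero)           ≡⟨ same-assignment (vertex j zero) ⟩
        assign c' (vertex j zero)          ≡⟨ assign-onCycle c' j zero ⟩
        orientedEdge (lookup c' j) j zero  ∎)

    module _ (ρ : Fin n → Fin n) (ρ-injective : Injective _≡_ _≡_ ρ) (ρ-isEnd : ∀ v → IsEnd (ρ v) v)
      where

      private
        bound : ℕ
        bound = max 0 (List.tabulate dist)

        dist≤bound : ∀ v → dist v ≤ bound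
        dist≤bound = tabulate⁻ (xs≤max 0 (List.tabulate dist))

      -- Descending induction on dist: were ρ v the parent edge of some u ≢ v, then u would lie farther
      -- from the cycles than v, and by induction ρ u would be that same edge.
      ρ-offCycle : ∀ v .(off : ¬ OnCycle v) → ρ v ≡ parentEdge v off
      ρ-offCycle v off = go (suc (bound ∸ dist v)) v off (n<1+n _)
        where
        go : ∀ fuel v .(off : ¬ OnCycle v) → bound ∸ dist v < fuel → ρ v ≡ parentEdge v off
        go (suc fuel) v off fuel-bound with every-edge-on-cycle-or-parent (ρ v)
        ... | inj₁ (j , x , e) =
              ⊥-elim-irr (off (isEnd-cycle-edge⇒onCycle (subst (λ i → IsEnd i v) (sym e) (ρ-isEnd v))))
        ... | inj₂ (u , off-u , e) with parentEdge-descends u off-u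
        ...   | w , l , closer with isEnd⇒linked l (subst (λ i → IsEnd i v) (sym e) (ρ-isEnd v))
        ...     | inj₁ refl = sym e
        ...     | inj₂ refl = ⊥-elim (<⇒≢ closer (cong dist (ρ-injective ρv≡ρu)))
          where
          ρv≡ρu : ρ v ≡ ρ u
          ρv≡ρu = trans (sym e) (sym (go fuel u off-u
                    (<-≤-trans (∸-monoʳ-< closer (dist≤bound u)) (≤-pred fuel-bound))))

      ρ-onCycle : ∀ j x → ρ (vertex j x) ≡ edge j x ⊎ ρ (vertex j x) ≡ edge j (prev x)
      ρ-onCycle j x with every-edge-on-cycle-or-parent (ρ (vertex j x))
      ... | inj₂ (u , off , e) = ⊥-elim (off (j , x , ρ-injective (trans (sym e) (sym (ρ-offCycle u off)))))
      ... | inj₁ (j' , y , e)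
        with cycle-edge-ends {j'} {y} (subst (λ i → IsEnd i (vertex j x)) (sym e) (ρ-isEnd (vertex j x)))
      ...   | inj₁ at-y with cycles-disjoint at-y
      ...     | refl = inj₁ (trans (sym e) (cong (edge j) (sym (vertex-injective j at-y))))
      ρ-onCycle j x | inj₁ (j' , y , e) | inj₂ at-next-y with cycles-disjoint at-next-y
      ...     | refl = inj₂ (trans (sym e) (cong (edge j) (begin
                y               ≡⟨ sym (prev-next y) ⟩
                prev (next y)   ≡⟨ cong prev (sym (vertex-injective j at-next-y)) ⟩
                prev x          ∎)))
        where open ≡-Reasoning

      ρ-forward : ∀ j x → ρ (vertex j x) ≡ edge j x → ρ (vertex j (next x)) ≡ edge j (next x)
      ρ-forward j x fwd with ρ-onCycle j (next x)
      ... | inj₁ fwd' = fwd'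
      ... | inj₂ bwd' = ⊥-elim (next≢ x (vertex-injective j (ρ-injective (begin
              ρ (vertex j (next x))  ≡⟨ bwd' ⟩
              edge j (prev (next x)) ≡⟨ cong (edge j) (prev-next x) ⟩
              edge j x               ≡⟨ sym fwd ⟩
              ρ (vertex j x)         ∎))))
        where open ≡-Reasoning

      -- Otherwise edge j x, whose ends are vertex j x and vertex j (next x), would be the image of neither.
      ρ-backward : ∀ j x → ρ (vertex j x) ≡ edge j (prev x) → ρ (vertex j (next x)) ≡ edge j x
      ρ-backward j x bwd with ρ-onCycle j (next x)
      ... | inj₂ bwd' = trans bwd' (cong (edge j) (prev-next x))
      ... | inj₁ fwd' with injective⇒surjective ρ ρ-injective (edge j x)
      ...   | w , w↦e with cycle-edge-ends (subst (λ i → IsEnd i w) w↦e (ρ-isEnd w))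
      ...     | inj₁ refl = ⊥-elim (prev≢ x (edge-injective j (trans (sym bwd) w↦e)))
      ...     | inj₂ refl = ⊥-elim (next≢ x (edge-injective j (trans (sym fwd') w↦e)))

      forward-everywhere : ∀ j → ρ (vertex j zero) ≡ edge j zero →
                           ∀ x → ρ (vertex j x) ≡ orientedEdge true j x
      forward-everywhere j fwd₀ = next-induction _ fwd₀ (ρ-forward j)

      backward-everywhere : ∀ j → ρ (vertex j zero) ≡ edge j (prev zero) →
                            ∀ x → ρ (vertex j x) ≡ orientedEdge false j x
      backward-everywhere j bwd₀ =
        next-induction _ bwd₀ (λ x bwd → trans (ρ-backward j x bwd) (cong (edge j) (sym (prev-next x))))

      orientation : Vec Bool k
      orientation = tabulate λ j → does (ρ (vertex j zero) Fin.≟ edge j zero)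

      ρ-oriented : ∀ j x → ρ (vertex j x) ≡ orientedEdge (lookup orientation j) j x
      ρ-oriented j x rewrite lookup∘tabulate (λ j → does (ρ (vertex j zero) Fin.≟ edge j zero)) j
        with ρ (vertex j zero) Fin.≟ edge j zero
      ... | yes fwd₀ = forward-everywhere j fwd₀ x
      ... | no ¬fwd₀ = backward-everywhere j ([ ⊥-elim ∘ ¬fwd₀ , id ] (ρ-onCycle j zero)) x

      ρ≗assign : ∀ v → ρ v ≡ assign orientation v
      ρ≗assign v with assign-view orientation v
      ... | on-cycle j x refl eq = trans (ρ-oriented j x) (sym eq)
      ... | off-cycle off eq     = trans (ρ-offCycle v off) (sym eq)

    matching-complete : ∀ σ → IsEndBijection σ → ∃ λ c → σ ≡ matching c
    matching-complete σ σ-bij =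
        orientation σ⁻¹ σ⁻¹-injective σ⁻¹-isEnd
      , ≡tabulate-inverse _ _ (ρ≗assign σ⁻¹ σ⁻¹-injective σ⁻¹-isEnd)
      where open EndBijection {σ} σ-bij

-- The graph G_W

-- Opaque so that unification never unfolds the corner-number computation.
opaque
  sharedCorners : ∀ c → sharedCount c ≡ 2 → ∃₂ λ a b → ∀ v → Incident c v ⇔ (v ≡ a ⊎ v ≡ b)
  sharedCorners c = Counting.count≡2⇒pair (_∈? cornerNumbers c) baCorner

allShareTwo : (W : Fin 8 → Coloring) → edgeCount W ≡ 8 → ∀ i → sharedCount (W i) ≡ 2
allShareTwo W eq = tabulate⁻ {f = W}
  (Counting.count≡length⇒all (λ c → sharedCount c ≟ 2) (List.tabulate W) (trans eq (sym (length-tabulate W))))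

cycle-connected : ∀ {W} (cy : Cycle W) x → Reachable W (Cycle.vs cy zero) (Cycle.vs cy x)
cycle-connected cy = next-induction _ ε λ x path → path ◅◅ return (Cycle.es cy x , Cycle.joins cy x)

module EdgeGraph (W : Fin 8 → Coloring) (shareTwo : ∀ i → sharedCount (W i) ≡ 2) where

  a b : Fin 8 → Fin 8
  a i = proj₁ (sharedCorners (W i) (shareTwo i))
  b i = proj₁ (proj₂ (sharedCorners (W i) (shareTwo i)))

  incident⇔isEnd : ∀ i v → Incident (W i) v ⇔ (v ≡ a i ⊎ v ≡ b i)
  incident⇔isEnd i = proj₂ (proj₂ (sharedCorners (W i) (shareTwo i)))

  open Graph a b public

  joins⇒links : ∀ {i u w} → Joins (W i) u w → Links i u w
  joins⇒links {i} {u} {w} (_ , u≢w , u-inc , w-inc)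
    with to (incident⇔isEnd i u) u-inc | to (incident⇔isEnd i w) w-inc
  ... | inj₁ refl | inj₁ refl = ⊥-elim (u≢w refl)
  ... | inj₁ refl | inj₂ refl = inj₁ (refl , refl)
  ... | inj₂ refl | inj₁ refl = inj₂ (refl , refl)
  ... | inj₂ refl | inj₂ refl = ⊥-elim (u≢w refl)

  reachable⇒path : ∀ {u w} → Reachable W u w → Star Adjacent u w
  reachable⇒path = Star.map λ (i , joins) → i , joins⇒links joins

  simpleCycle : Cycle W → SimpleCycle
  simpleCycle cy = record
    { m                = Cycle.m cy
    ; vertex           = Cycle.vs cy
    ; edge             = Cycle.es cy
    ; vertex-injective = Cycle.vsInj cy _ _
    ; edge-injective   = Cycle.esInj cy _ _
    ; links            = joins⇒links ∘ Cycle.joins cy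
    }

  isSolution⇔isEndBijection : ∀ σ → IsSolution W σ ⇔ IsEndBijection σ
  isSolution⇔isEndBijection σ = mk⇔
    (λ (inj , surj , inc) → inj _ _ , surj , λ i → to (incident⇔isEnd i _) (inc i))
    (λ (inj , surj , end) → (λ _ _ → inj) , surj , λ i → from (incident⇔isEnd i _) (end i))

module Components (W : Fin 8 → Coloring) (components : NumComponents W k) (noTree : NoTreeComponent W) where

  component : Fin 8 → Fin k
  component = proj₁ components

  representative : Fin k → Fin 8
  representative j = proj₁ (proj₁ (proj₂ components) j)

  sameComponent⇔reachable : ∀ u v → component u ≡ component v ⇔ Reachable W u v
  sameComponent⇔reachable = proj₂ (proj₂ components)

  cycleOf : Fin k → Cycle W
  cycleOf j = proj₁ (noTree (representative j))

  cycleOf-component : ∀ j x → component (Cycle.vs (cycleOf j) x) ≡ j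
  cycleOf-component j x = begin
    component (Cycle.vs (cycleOf j) x) ≡⟨ sym (from (sameComponent⇔reachable _ _) path) ⟩
    component (representative j)       ≡⟨ proj₂ (proj₁ (proj₂ components) j) ⟩
    j                                  ∎
    where
    open ≡-Reasoning
    path : Reachable W (representative j) (Cycle.vs (cycleOf j) x)
    path = proj₂ (noTree (representative j)) ◅◅ cycle-connected (cycleOf j) x

  cycles-disjoint : ∀ {j j' x x'} → Cycle.vs (cycleOf j) x ≡ Cycle.vs (cycleOf j') x' → j ≡ j'
  cycles-disjoint {j} {j'} {x} {x'} eq =
    trans (sym (cycleOf-component j x)) (trans (cong component eq) (cycleOf-component j' x'))

  reaches-own-cycle : ∀ v → Reachable W v (Cycle.vs (cycleOf (component v)) zero)
  reaches-own-cycle v = to (sameComponent⇔reachable _ _) (sym (cycleOf-component (component v) zero))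

solutionNumber : (W : Fin 8 → Coloring) → edgeCount W ≡ 8 → NoTreeComponent W →
                 NumComponents W k → SolutionNumber W (2 ^ k)
solutionNumber W edges8 noTree components =
  enumerated-by-boolVecs matching matching-injective
    (λ c → from (isSolution⇔isEndBijection (matching c)) (matching-isEndBijection c))
    (λ σ σ-sol → matching-complete σ (to (isSolution⇔isEndBijection σ) σ-sol))
  where
  open EdgeGraph W (allShareTwo W edges8)
  open Components W components noTree
  open Orientations (simpleCycle ∘ cycleOf) cycles-disjoint
                    (λ v → component v , reachable⇒path (reaches-own-cycle v))

lemma10 : (W : Fin 8 → Coloring)
    → (∀ i → IsMacMahon (W i))
    → (∀ i j → i ≢ j → ¬ SameCube (W i) (W j))
    → edgeCount W ≡ 8
    → NoTreeComponent W
    → (NumComponents W 3 → SolutionNumber W 8) × (NumComponents W 4 → SolutionNumber W 16)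
lemma10 W _ _ edges8 noTree = solutionNumber W edges8 noTree , solutionNumber W edges8 noTree
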